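{- Let $d>2$ be an integer, let $\ell$ be a prime dividing $d$, and set $d'=d/\ell$. Suppose $\chi$ is a non-trivial Dirichlet character modulo $d$ induced by a Dirichlet character $\chi'$ modulo $d'$. If $\ell=2$, then $c_\chi=-\chi'(2)c_{\chi'}$. If $\ell$ is odd, then $c_\chi=(1-\chi'(\ell))c_{\chi'}$. Here $\chi'(\ell)=0$ if $\ell\mid d'$ (and likewise $\chi'(2)=0$ if $2\mid d'$).
   Context: For a Dirichlet character $\psi$ modulo $n$ (with $\psi(a)=0$ when $\gcd(a,n)>1$), $c_\psi=\sum_{0<a<n/2}\psi(a)$; thus $c_\chi=\sum_{0<a<d/2}\chi(a)$ and $c_{\chi'}=\sum_{0<a<d'/2}\chi'(a)$. -}

module Defs where

open import Level using (_⊔_)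
open import Algebra.Bundles using (CommutativeRing)
open import Data.Nat using (ℕ; zero; suc; _∸_; _/_) renaming (_+_ to _+ℕ_; _*_ to _*ℕ_)
open import Data.Nat.GCD using (gcd)
open import Data.Sum using (_⊎_)
open import Data.Product using (∃; _×_)
open import Relation.Nullary using (¬_)
open import Relation.Binary.PropositionalEquality using (_≡_; _≢_)

module _ {c ℓ} (R : CommutativeRing c ℓ) where
  open CommutativeRing R

  NoZeroDivisors : Set (c ⊔ ℓ)
  NoZeroDivisors = ∀ x y → (x * y) ≈ 0# → x ≈ 0# ⊎ y ≈ 0#

  -- A Dirichlet character modulo n with values in R, viewed on ℕ
  -- (it determines the character on ℤ by periodicity).
  record IsDirichletCharacter (n : ℕ) (χ : ℕ → Carrier) : Set (c ⊔ ℓ) where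
    field
      periodic      : ∀ a → χ (a +ℕ n) ≈ χ a
      multiplicative : ∀ a b → χ (a *ℕ b) ≈ (χ a * χ b)
      one           : χ 1 ≈ 1#
      zero-off      : ∀ a → gcd a n ≢ 1 → χ a ≈ 0#
      nonzero-on    : ∀ a → gcd a n ≡ 1 → ¬ (χ a ≈ 0#)

  -- χ (mod d) is induced by χ' (mod d'): they agree on integers coprime to d
  -- (and χ vanishes elsewhere by IsDirichletCharacter.zero-off).
  InducedBy : (d : ℕ) (χ χ' : ℕ → Carrier) → Set ℓ
  InducedBy d χ χ' = ∀ a → gcd a d ≡ 1 → χ a ≈ χ' a

  NonTrivial : (n : ℕ) (χ : ℕ → Carrier) → Set ℓ
  NonTrivial n χ = ∃ λ a → gcd a n ≡ 1 × ¬ (χ a ≈ 1#)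

  sumFrom1 : (ℕ → Carrier) → ℕ → Carrier
  sumFrom1 ψ zero = 0#
  sumFrom1 ψ (suc k) = sumFrom1 ψ k + ψ (suc k)

  -- c_ψ = Σ_{0<a<n/2} ψ(a); note 0 < a < n/2 ⟺ 1 ≤ a ≤ ⌊(n-1)/2⌋.
  cSum : (ψ : ℕ → Carrier) (n : ℕ) → Carrier
  cSum ψ n = sumFrom1 ψ ((n ∸ 1) / 2)

{-# OPTIONS --safe #-}
module Submission where

-- With N = ⌊(d-1)/2⌋, the terms of Σ_{a≤N} χ'(a) with ℓ ∤ a are exactly those of c_χ, while the
-- multiples a = ℓb contribute χ'(ℓ) Σ_{b≤⌊N/ℓ⌋} χ'(b) = χ'(ℓ) c_{χ'}, because ⌊N/ℓ⌋ = ⌊(d'-1)/2⌋.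
-- Since χ' is non-trivial, its sum over a full period vanishes (multiplying by a unit permutes the
-- residues). For ℓ = 2, N = d' - 1, so Σ_{a≤N} χ'(a) is a full period minus χ'(d') = 0; for odd
-- ℓ = 2k + 1, N = ⌊(d'-1)/2⌋ + k d', so Σ_{a≤N} χ'(a) = c_{χ'}.

open import Defs
open import Algebra.Bundles using (CommutativeRing)
open import Data.Nat using (ℕ; _<_) renaming (_*_ to _*ℕ_)
open import Data.Nat.Primality using (Prime)
open import Data.Product using (_×_)
open import Relation.Binary.PropositionalEquality using (_≡_; _≢_)

module Arithmetic where
  open import Data.Nat
  open import Data.Nat.Properties
  open import Data.Nat.DivMod
  open import Data.Nat.Divisibility
  open import Data.Nat.Coprimality using (Coprime; coprime-divisor; coprime-Bézout)
  import Data.Nat.GCD as GCD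
  open import Data.Nat.Primality using (Prime; prime⇒irreducible; ¬prime[1])
  open import Data.Nat.Tactic.RingSolver using (solve-∀)
  open import Data.Fin using (Fin; toℕ; fromℕ<)
  open import Data.Fin.Properties using (toℕ-injective; toℕ<n; toℕ-fromℕ<)
  open import Data.Product using (∃; _,_)
  open import Data.Sum using (inj₁; inj₂)
  open import Relation.Nullary using (¬_; Dec; yes; no; contradiction)
  open import Relation.Binary.PropositionalEquality

  [m+kn]/n≡k : ∀ {m} k n .{{_ : NonZero n}} → m < n → (m + k * n) / n ≡ k
  [m+kn]/n≡k {m} k n m<n = begin
    (m + k * n) / n     ≡⟨ +-distrib-/-∣ʳ m (divides-refl k) ⟩
    m / n + k * n / n   ≡⟨ cong₂ _+_ (m<n⇒m/n≡0 m<n) (m*n/n≡m k n) ⟩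
    k                   ∎
    where open ≡-Reasoning

  [m*n∸1]/2/n≡[m∸1]/2 : ∀ m n .{{_ : NonZero n}} → (m * n ∸ 1) / 2 / n ≡ (m ∸ 1) / 2
  [m*n∸1]/2/n≡[m∸1]/2 zero n = 0/n≡0 n
  [m*n∸1]/2/n≡[m∸1]/2 (suc t) n@(suc l) = begin
    (l + t * n) / 2 / n                          ≡⟨ m/n/o≡m/[n*o] (l + t * n) 2 n ⟩
    (l + t * n) / (2 * n)                        ≡⟨ /-congˡ t-halved ⟩
    (l + t % 2 * n + t / 2 * (2 * n)) / (2 * n)  ≡⟨ [m+kn]/n≡k (t / 2) (2 * n) remainder<2n ⟩
    t / 2                                        ∎
    where
    open ≡-Reasoning
    t-halved : l + t * n ≡ l + t % 2 * n + t / 2 * (2 * n)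
    t-halved = trans (cong (λ s → l + s * n) (m≡m%n+[m/n]*n t 2)) (regroup l (t % 2) (t / 2) n)
      where
      regroup : ∀ l e r n → l + (e + r * 2) * n ≡ l + e * n + r * (2 * n)
      regroup = solve-∀
    remainder<2n : l + t % 2 * n < 2 * n
    remainder<2n = s≤s (+-monoʳ-≤ l (*-monoˡ-≤ n (≤-pred (m%n<n t 2))))

  [m*[1+k*2]∸1]/2≡[m∸1]/2+k*m : ∀ m k → (m * suc (k * 2) ∸ 1) / 2 ≡ (m ∸ 1) / 2 + k * m
  [m*[1+k*2]∸1]/2≡[m∸1]/2+k*m zero k = sym (*-zeroʳ k)
  [m*[1+k*2]∸1]/2≡[m∸1]/2+k*m (suc t) k = begin
    (k * 2 + t * suc (k * 2)) / 2  ≡⟨ /-congˡ (regroup k t) ⟩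
    (t + k * suc t * 2) / 2        ≡⟨ +-distrib-/-∣ʳ t (divides-refl (k * suc t)) ⟩
    t / 2 + k * suc t * 2 / 2      ≡⟨ cong (t / 2 +_) (m*n/n≡m (k * suc t) 2) ⟩
    t / 2 + k * suc t              ∎
    where
    open ≡-Reasoning
    regroup : ∀ k t → k * 2 + t * suc (k * 2) ≡ t + k * suc t * 2
    regroup = solve-∀

  [m*2∸1]/2≡m∸1 : ∀ m → (m * 2 ∸ 1) / 2 ≡ m ∸ 1
  [m*2∸1]/2≡m∸1 zero = refl
  [m*2∸1]/2≡m∸1 (suc t) = [m+kn]/n≡k t 2 (s≤s (s≤s z≤n))

  data SucQuotient (n k : ℕ) .{{_ : NonZero k}} : Set where
    same-quotient : suc n / k ≡ n / k → ¬ k ∣ suc n → SucQuotient n k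
    next-multiple : suc n ≡ suc (n / k) * k → SucQuotient n k

  sucQuotient : ∀ n k .{{_ : NonZero k}} → SucQuotient n k
  sucQuotient n k = classify (suc (n % k) <? k)
    where
    open ≡-Reasoning
    n+1≡ : suc n ≡ suc (n % k) + n / k * k
    n+1≡ = cong suc (m≡m%n+[m/n]*n n k)
    classify : Dec (suc (n % k) < k) → SucQuotient n k
    classify (yes r<k) = same-quotient (trans (/-congˡ n+1≡) ([m+kn]/n≡k (n / k) k r<k)) k∤n+1
      where
      k∤n+1 : ¬ k ∣ suc n
      k∤n+1 k∣n+1 = 1+n≢0 (begin
        suc (n % k)                    ≡⟨ m<n⇒m%n≡m r<k ⟨
        suc (n % k) % k                ≡⟨ [m+kn]%n≡m%n (suc (n % k)) (n / k) k ⟨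
        (suc (n % k) + n / k * k) % k  ≡⟨ %-congˡ n+1≡ ⟨
        suc n % k                      ≡⟨ n∣m⇒m%n≡0 (suc n) k k∣n+1 ⟩
        0                              ∎)
    classify (no r≮k) = next-multiple (trans n+1≡ (cong (_+ n / k * k) (≤-antisym (m%n<n n k) (≮⇒≥ r≮k))))

  odd-prime : ∀ {p} → Prime p → p ≢ 2 → p ≡ suc (p / 2 * 2)
  odd-prime {p} p-prime p≢2 = trans (m≡m%n+[m/n]*n p 2) (cong (_+ p / 2 * 2) (p%2≡1 (p % 2) refl (m%n<n p 2)))
    where
    p%2≡1 : ∀ r → p % 2 ≡ r → r < 2 → r ≡ 1
    p%2≡1 zero p%2≡0 _ with prime⇒irreducible p-prime (m%n≡0⇒n∣m p 2 p%2≡0)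
    ... | inj₁ ()
    ... | inj₂ 2≡p = contradiction (sym 2≡p) p≢2
    p%2≡1 (suc zero) _ _ = refl
    p%2≡1 (suc (suc _)) _ (s≤s (s≤s ()))

  prime-∣-common⇒¬coprime : ∀ {p a n} → Prime p → p ∣ a → p ∣ n → ¬ Coprime a n
  prime-∣-common⇒¬coprime p-prime p∣a p∣n coprime = ¬prime[1] (subst Prime (coprime (p∣a , p∣n)) p-prime)

  prime∤⇒coprime : ∀ {p a} → Prime p → ¬ p ∣ a → Coprime a p
  prime∤⇒coprime p-prime p∤a (i∣a , i∣p) with prime⇒irreducible p-prime i∣p
  ... | inj₁ i≡1 = i≡1
  ... | inj₂ refl = contradiction i∣a p∤a

  coprime-* : ∀ {a m n} → Coprime a m → Coprime a n → Coprime a (m * n)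
  coprime-* coprime-m coprime-n (i∣a , i∣mn) =
    coprime-n (i∣a , coprime-divisor (λ (j∣i , j∣m) → coprime-m (∣-trans j∣i i∣a , j∣m)) i∣mn)

  coprime-∣ʳ : ∀ {a m n} → n ∣ m → Coprime a m → Coprime a n
  coprime-∣ʳ n∣m coprime (i∣a , i∣n) = coprime (i∣a , ∣-trans i∣n n∣m)

  coprime⇒∃inverse : ∀ {g n} .{{_ : NonZero n}} → Coprime g n → ∃ λ h → (h * g) % n ≡ 1 % n
  coprime⇒∃inverse {g} {suc e} coprime with coprime-Bézout coprime
  ... | GCD.Bézout.+- x y eq = x , trans (cong (_% suc e) (sym eq)) ([m+kn]%n≡m%n 1 y (suc e))
  ... | GCD.Bézout.-+ x y eq = x * e , (begin
      (x * e * g) % suc e            ≡⟨ [m+n]%n≡m%n (x * e * g) (suc e) ⟨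
      (x * e * g + suc e) % suc e    ≡⟨ cong (_% suc e) shifted ⟩
      (1 + y * e * suc e) % suc e    ≡⟨ [m+kn]%n≡m%n 1 (y * e) (suc e) ⟩
      1 % suc e                      ∎)
    where
    open ≡-Reasoning
    shifted : x * e * g + suc e ≡ 1 + y * e * suc e
    shifted = trans (expand₁ x g e) (trans (cong (λ z → z * e + 1) eq) (expand₂ y e))
      where
      expand₁ : ∀ x g e → x * e * g + suc e ≡ (1 + x * g) * e + 1
      expand₁ = solve-∀
      expand₂ : ∀ y e → y * suc e * e + 1 ≡ 1 + y * e * suc e
      expand₂ = solve-∀

  mulMod : ∀ n .{{_ : NonZero n}} → ℕ → Fin n → Fin n
  mulMod n g i = fromℕ< (m%n<n (g * toℕ i) n)

  toℕ-mulMod : ∀ n .{{_ : NonZero n}} g i → toℕ (mulMod n g i) ≡ (g * toℕ i) % n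
  toℕ-mulMod n g i = toℕ-fromℕ< (m%n<n (g * toℕ i) n)

  [m*[n%o]]%o≡[m*n]%o : ∀ m n o .{{_ : NonZero o}} → (m * (n % o)) % o ≡ (m * n) % o
  [m*[n%o]]%o≡[m*n]%o m n o = begin
    (m * (n % o)) % o              ≡⟨ %-distribˡ-* m (n % o) o ⟩
    ((m % o) * (n % o % o)) % o    ≡⟨ cong (λ x → ((m % o) * x) % o) (m%n%n≡m%n n o) ⟩
    ((m % o) * (n % o)) % o        ≡⟨ %-distribˡ-* m n o ⟨
    (m * n) % o                    ∎
    where open ≡-Reasoning

  mulMod-inverse : ∀ n .{{_ : NonZero n}} {g h} → (h * g) % n ≡ 1 % n → ∀ i → mulMod n h (mulMod n g i) ≡ i
  mulMod-inverse n {g} {h} hg≡1 i = toℕ-injective (begin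
    toℕ (mulMod n h (mulMod n g i))  ≡⟨ toℕ-mulMod n h (mulMod n g i) ⟩
    (h * toℕ (mulMod n g i)) % n     ≡⟨ cong (λ z → (h * z) % n) (toℕ-mulMod n g i) ⟩
    (h * ((g * toℕ i) % n)) % n    ≡⟨ [m*[n%o]]%o≡[m*n]%o h (g * toℕ i) n ⟩
    (h * (g * toℕ i)) % n          ≡⟨ cong (_% n) (trans (sym (*-assoc h g (toℕ i))) (*-comm (h * g) (toℕ i))) ⟩
    (toℕ i * (h * g)) % n          ≡⟨ [m*[n%o]]%o≡[m*n]%o (toℕ i) (h * g) n ⟨
    (toℕ i * ((h * g) % n)) % n    ≡⟨ cong (λ z → (toℕ i * z) % n) hg≡1 ⟩
    (toℕ i * (1 % n)) % n          ≡⟨ [m*[n%o]]%o≡[m*n]%o (toℕ i) 1 n ⟩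
    (toℕ i * 1) % n                ≡⟨ cong (_% n) (*-identityʳ (toℕ i)) ⟩
    toℕ i % n                      ≡⟨ m<n⇒m%n≡m (toℕ<n i) ⟩
    toℕ i                          ∎)
    where open ≡-Reasoning

module CharacterSums {c r} (R : CommutativeRing c r) where
  open CommutativeRing R
  open import Algebra.Properties.Ring ring using (//-rightDividesʳ; [y-z]x≈yx-zx; x∙y⁻¹≈ε⇒x≈y)
  open import Algebra.Properties.Semiring.Sum semiring using (sum; sum-cong-≋; sum-cong-≗; sum-init-last; sum-permute; *-distribˡ-sum)
  open import Relation.Binary.Reasoning.Setoid setoid
  open import Data.Nat using (ℕ; zero; suc; NonZero; _∸_) renaming (_+_ to _+ℕ_; _*_ to _*ℕ_)
  open import Data.Nat.DivMod using (_/_; _%_; m≡m%n+[m/n]*n; 0/n≡0; m*n/n≡m; /-congˡ)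
  import Data.Nat.Properties as ℕ
  open import Data.Nat.Divisibility using (_∣_; divides; m∣m*n; n∣m*n; ∣-refl)
  open import Data.Nat.GCD using (gcd; gcd-identityʳ)
  open import Data.Nat.Coprimality using (Coprime; gcd≡1⇒coprime; coprime⇒gcd≡1)
  open import Data.Fin using (Fin; toℕ; fromℕ; inject₁)
  open import Data.Fin.Properties using (toℕ-inject₁; toℕ-fromℕ)
  open import Data.Fin.Permutation using (Permutation; permutation)
  open import Data.Product using (_,_)
  open import Data.Sum using (inj₁; inj₂)
  open import Function using (_∘_)
  open import Data.Nat.Primality using (Prime; prime⇒nonZero)
  open import Relation.Nullary using (¬_; yes; no; contradiction)
  import Relation.Binary.PropositionalEquality as ≡
  open Arithmetic

  Periodic : ℕ → (ℕ → Carrier) → Set r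
  Periodic n ψ = ∀ a → ψ (a +ℕ n) ≈ ψ a

  Multiplicative : (ℕ → Carrier) → Set r
  Multiplicative ψ = ∀ a b → ψ (a *ℕ b) ≈ ψ a * ψ b

  x+ky≈y⇒x≈[1-k]y : ∀ x k y → x + k * y ≈ y → x ≈ (1# - k) * y
  x+ky≈y⇒x≈[1-k]y x k y x+ky≈y = begin
    x                  ≈⟨ //-rightDividesʳ (k * y) x ⟨
    (x + k * y) - k * y ≈⟨ +-congʳ x+ky≈y ⟩
    y - k * y          ≈⟨ +-congʳ (*-identityˡ y) ⟨
    1# * y - k * y     ≈⟨ [y-z]x≈yx-zx y 1# k ⟨
    (1# - k) * y       ∎

  a*x≈x⇒x≈0 : NoZeroDivisors R → ∀ {a x} → ¬ a ≈ 1# → a * x ≈ x → x ≈ 0#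
  a*x≈x⇒x≈0 domain {a} {x} a≉1 ax≈x with domain (a - 1#) x [a-1]x≈0
    where
    [a-1]x≈0 : (a - 1#) * x ≈ 0#
    [a-1]x≈0 = begin
      (a - 1#) * x    ≈⟨ [y-z]x≈yx-zx x a 1# ⟩
      a * x - 1# * x  ≈⟨ +-cong ax≈x (-‿cong (*-identityˡ x)) ⟩
      x - x           ≈⟨ -‿inverseʳ x ⟩
      0#              ∎
  ... | inj₁ a-1≈0 = contradiction (x∙y⁻¹≈ε⇒x≈y a 1# a-1≈0) a≉1
  ... | inj₂ x≈0 = x≈0

  periodic-* : ∀ {n ψ} → Periodic n ψ → ∀ a k → ψ (a +ℕ k *ℕ n) ≈ ψ a
  periodic-* {ψ = ψ} per a zero = reflexive (≡.cong ψ (ℕ.+-identityʳ a))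
  periodic-* {n} {ψ} per a (suc k) = begin
    ψ (a +ℕ (n +ℕ k *ℕ n))  ≡⟨ ≡.cong ψ (ℕ.+-assoc a n (k *ℕ n)) ⟨
    ψ (a +ℕ n +ℕ k *ℕ n)    ≈⟨ periodic-* per (a +ℕ n) k ⟩
    ψ (a +ℕ n)              ≈⟨ per a ⟩
    ψ a                     ∎

  periodic-% : ∀ {n ψ} .{{_ : NonZero n}} → Periodic n ψ → ∀ a → ψ (a % n) ≈ ψ a
  periodic-% {n} {ψ} per a = begin
    ψ (a % n)                ≈⟨ periodic-* per (a % n) (a / n) ⟨
    ψ (a % n +ℕ a / n *ℕ n)  ≡⟨ ≡.cong ψ (m≡m%n+[m/n]*n a n) ⟨
    ψ a                      ∎

  sumFrom1-+-period : ∀ {n ψ} → Periodic n ψ → ∀ m → sumFrom1 R ψ (m +ℕ n) ≈ sumFrom1 R ψ m + sumFrom1 R ψ n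
  sumFrom1-+-period per zero = sym (+-identityˡ _)
  sumFrom1-+-period {n} {ψ} per (suc m) = begin
    sumFrom1 R ψ (m +ℕ n) + ψ (suc m +ℕ n)             ≈⟨ +-cong (sumFrom1-+-period per m) (per (suc m)) ⟩
    (sumFrom1 R ψ m + sumFrom1 R ψ n) + ψ (suc m)      ≈⟨ +-assoc _ _ _ ⟩
    sumFrom1 R ψ m + (sumFrom1 R ψ n + ψ (suc m))      ≈⟨ +-congˡ (+-comm _ _) ⟩
    sumFrom1 R ψ m + (ψ (suc m) + sumFrom1 R ψ n)      ≈⟨ +-assoc _ _ _ ⟨
    (sumFrom1 R ψ m + ψ (suc m)) + sumFrom1 R ψ n      ∎

  sumFrom1-+-periods : ∀ {n ψ} → Periodic n ψ → sumFrom1 R ψ n ≈ 0# →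
                       ∀ m k → sumFrom1 R ψ (m +ℕ k *ℕ n) ≈ sumFrom1 R ψ m
  sumFrom1-+-periods {ψ = ψ} per period≈0 m zero = reflexive (≡.cong (sumFrom1 R ψ) (ℕ.+-identityʳ m))
  sumFrom1-+-periods {n} {ψ} per period≈0 m (suc k) = begin
    sumFrom1 R ψ (m +ℕ (n +ℕ k *ℕ n))                   ≡⟨ ≡.cong (sumFrom1 R ψ) (ℕ.+-assoc m n (k *ℕ n)) ⟨
    sumFrom1 R ψ (m +ℕ n +ℕ k *ℕ n)                     ≈⟨ sumFrom1-+-periods per period≈0 (m +ℕ n) k ⟩
    sumFrom1 R ψ (m +ℕ n)                               ≈⟨ sumFrom1-+-period per m ⟩
    sumFrom1 R ψ m + sumFrom1 R ψ n                     ≈⟨ +-congˡ period≈0 ⟩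
    sumFrom1 R ψ m + 0#                                 ≈⟨ +-identityʳ _ ⟩
    sumFrom1 R ψ m                                      ∎

  sum-toℕ≈ψ0+sumFrom1 : ∀ ψ n → sum {suc n} (ψ ∘ toℕ) ≈ ψ 0 + sumFrom1 R ψ n
  sum-toℕ≈ψ0+sumFrom1 ψ zero = refl
  sum-toℕ≈ψ0+sumFrom1 ψ (suc n) = begin
    sum {suc (suc n)} (ψ ∘ toℕ)                   ≈⟨ sum-init-last {suc n} (ψ ∘ toℕ) ⟩
    sum {suc n} (ψ ∘ toℕ ∘ inject₁) + ψ (toℕ (fromℕ (suc n)))
      ≡⟨ ≡.cong₂ _+_ (sum-cong-≗ {suc n} (≡.cong ψ ∘ toℕ-inject₁)) (≡.cong ψ (toℕ-fromℕ (suc n))) ⟩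
    sum {suc n} (ψ ∘ toℕ) + ψ (suc n)             ≈⟨ +-congʳ (sum-toℕ≈ψ0+sumFrom1 ψ n) ⟩
    (ψ 0 + sumFrom1 R ψ n) + ψ (suc n)            ≈⟨ +-assoc _ _ _ ⟩
    ψ 0 + sumFrom1 R ψ (suc n)                    ∎

  sumFrom1-period≈sum : ∀ {n ψ} .{{_ : NonZero n}} → Periodic n ψ → sumFrom1 R ψ n ≈ sum {n} (ψ ∘ toℕ)
  sumFrom1-period≈sum {suc e} {ψ} per = begin
    sumFrom1 R ψ e + ψ (suc e)  ≈⟨ +-congˡ (per 0) ⟩
    sumFrom1 R ψ e + ψ 0        ≈⟨ +-comm _ _ ⟩
    ψ 0 + sumFrom1 R ψ e        ≈⟨ sum-toℕ≈ψ0+sumFrom1 ψ e ⟨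
    sum {suc e} (ψ ∘ toℕ)       ∎

  sumFrom1-period-invariant : ∀ {n ψ g} .{{_ : NonZero n}} → Periodic n ψ → Multiplicative ψ →
                              Coprime g n → ψ g * sumFrom1 R ψ n ≈ sumFrom1 R ψ n
  sumFrom1-period-invariant {n} {ψ} {g} per mult coprime with coprime⇒∃inverse coprime
  ... | h , hg≡1 = begin
    ψ g * sumFrom1 R ψ n              ≈⟨ *-congˡ (sumFrom1-period≈sum per) ⟩
    ψ g * sum f                       ≈⟨ *-distribˡ-sum (ψ g) f ⟩
    sum (λ i → ψ g * f i)             ≈⟨ sum-cong-≋ (λ i → sym (f∘mulMod≈ i)) ⟩
    sum (f ∘ mulMod n g)              ≈⟨ sum-permute f π ⟨
    sum f                             ≈⟨ sumFrom1-period≈sum per ⟨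
    sumFrom1 R ψ n                    ∎
    where
    f : Fin n → Carrier
    f = ψ ∘ toℕ
    f∘mulMod≈ : ∀ i → f (mulMod n g i) ≈ ψ g * f i
    f∘mulMod≈ i = begin
      ψ (toℕ (mulMod n g i))   ≡⟨ ≡.cong ψ (toℕ-mulMod n g i) ⟩
      ψ ((g *ℕ toℕ i) % n)     ≈⟨ periodic-% per (g *ℕ toℕ i) ⟩
      ψ (g *ℕ toℕ i)           ≈⟨ mult g (toℕ i) ⟩
      ψ g * f i                ∎
    gh≡1 : (g *ℕ h) % n ≡.≡ 1 % n
    gh≡1 = ≡.trans (≡.cong (_% n) (ℕ.*-comm g h)) hg≡1
    π : Permutation n n
    π = permutation {n} {n} (mulMod n g) (mulMod n h) (mulMod-inverse n {h} {g} gh≡1) (mulMod-inverse n {g} {h} hg≡1)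

  nonTrivial⇒sumFrom1-period≈0 : NoZeroDivisors R → ∀ {n ψ} → IsDirichletCharacter R n ψ → NonTrivial R n ψ →
                                 sumFrom1 R ψ n ≈ 0#
  -- gcd g 0 = g, so modulo 0 the only unit is 1.
  nonTrivial⇒sumFrom1-period≈0 domain {zero} {ψ} ψ-char (g , gcd≡1 , ψg≉1) =
    contradiction (≡.subst (λ a → ψ a ≈ 1#) (≡.sym (≡.trans (≡.sym (gcd-identityʳ g)) gcd≡1)) one) ψg≉1
    where open IsDirichletCharacter ψ-char
  nonTrivial⇒sumFrom1-period≈0 domain {suc e} ψ-char (g , gcd≡1 , ψg≉1) =
    a*x≈x⇒x≈0 domain ψg≉1 (sumFrom1-period-invariant periodic multiplicative (gcd≡1⇒coprime gcd≡1))
    where open IsDirichletCharacter ψ-char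

  sumFrom1-split-multiples : ∀ {ℓ} .{{_ : NonZero ℓ}} {χ χ' : ℕ → Carrier} →
    (∀ a → ℓ ∣ a → χ a ≈ 0#) → (∀ a → ¬ ℓ ∣ a → χ a ≈ χ' a) → Multiplicative χ' →
    ∀ n → sumFrom1 R χ n + χ' ℓ * sumFrom1 R χ' (n / ℓ) ≈ sumFrom1 R χ' n
  sumFrom1-split-multiples {ℓ} {χ} {χ'} on-multiples off-multiples mult zero = begin
    0# + χ' ℓ * sumFrom1 R χ' (0 / ℓ)  ≈⟨ +-identityˡ _ ⟩
    χ' ℓ * sumFrom1 R χ' (0 / ℓ)       ≡⟨ ≡.cong (λ q → χ' ℓ * sumFrom1 R χ' q) (0/n≡0 ℓ) ⟩
    χ' ℓ * 0#                          ≈⟨ zeroʳ _ ⟩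
    0#                                 ∎
  sumFrom1-split-multiples {ℓ} {χ} {χ'} on-multiples off-multiples mult (suc n)
    with sumFrom1-split-multiples on-multiples off-multiples mult n | sucQuotient n ℓ
  ... | split-n | same-quotient [n+1]/ℓ≡n/ℓ ℓ∤n+1 = begin
    (S χ n + χ (suc n)) + χ' ℓ * S χ' (suc n / ℓ)  ≡⟨ ≡.cong (λ q → (S χ n + χ (suc n)) + χ' ℓ * S χ' q) [n+1]/ℓ≡n/ℓ ⟩
    (S χ n + χ (suc n)) + χ' ℓ * S χ' (n / ℓ)      ≈⟨ +-assoc _ _ _ ⟩
    S χ n + (χ (suc n) + χ' ℓ * S χ' (n / ℓ))      ≈⟨ +-congˡ (+-comm _ _) ⟩
    S χ n + (χ' ℓ * S χ' (n / ℓ) + χ (suc n))      ≈⟨ +-assoc _ _ _ ⟨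
    (S χ n + χ' ℓ * S χ' (n / ℓ)) + χ (suc n)      ≈⟨ +-cong split-n (off-multiples (suc n) ℓ∤n+1) ⟩
    S χ' n + χ' (suc n)                            ∎
    where
    S : (ℕ → Carrier) → ℕ → Carrier
    S = sumFrom1 R
  ... | split-n | next-multiple n+1≡[q+1]ℓ = begin
    (S χ n + χ (suc n)) + χ' ℓ * S χ' (suc n / ℓ)        ≈⟨ +-cong (+-congˡ (on-multiples (suc n) (divides (suc q) n+1≡[q+1]ℓ)))
                                                                    (reflexive (≡.cong (λ m → χ' ℓ * S χ' m) [n+1]/ℓ≡q+1)) ⟩
    (S χ n + 0#) + χ' ℓ * (S χ' q + χ' (suc q))          ≈⟨ +-cong (+-identityʳ _) (distribˡ _ _ _) ⟩
    S χ n + (χ' ℓ * S χ' q + χ' ℓ * χ' (suc q))          ≈⟨ +-assoc _ _ _ ⟨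
    (S χ n + χ' ℓ * S χ' q) + χ' ℓ * χ' (suc q)          ≈⟨ +-cong split-n (sym χ'[n+1]≈) ⟩
    S χ' n + χ' (suc n)                                  ∎
    where
    S : (ℕ → Carrier) → ℕ → Carrier
    S = sumFrom1 R
    q : ℕ
    q = n / ℓ
    [n+1]/ℓ≡q+1 : suc n / ℓ ≡.≡ suc q
    [n+1]/ℓ≡q+1 = ≡.trans (/-congˡ n+1≡[q+1]ℓ) (m*n/n≡m (suc q) ℓ)
    χ'[n+1]≈ : χ' (suc n) ≈ χ' ℓ * χ' (suc q)
    χ'[n+1]≈ = begin
      χ' (suc n)              ≡⟨ ≡.cong χ' n+1≡[q+1]ℓ ⟩
      χ' (suc q *ℕ ℓ)         ≈⟨ mult (suc q) ℓ ⟩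
      χ' (suc q) * χ' ℓ       ≈⟨ *-comm _ _ ⟩
      χ' ℓ * χ' (suc q)       ∎

  zero-on-prime-multiples : ∀ {n ψ p} → IsDirichletCharacter R n ψ → Prime p → p ∣ n → ∀ a → p ∣ a → ψ a ≈ 0#
  zero-on-prime-multiples ψ-char p-prime p∣n a p∣a =
    zero-off a (prime-∣-common⇒¬coprime p-prime p∣a p∣n ∘ gcd≡1⇒coprime)
    where open IsDirichletCharacter ψ-char

  induced-off-multiples : ∀ {d' ℓ χ χ'} → Prime ℓ → IsDirichletCharacter R (d' *ℕ ℓ) χ → IsDirichletCharacter R d' χ' →
                          InducedBy R (d' *ℕ ℓ) χ χ' → ∀ a → ¬ ℓ ∣ a → χ a ≈ χ' a
  induced-off-multiples {d'} {ℓ} ℓ-prime χ-char χ'-char induced a ℓ∤a with gcd a (d' *ℕ ℓ) ℕ.≟ 1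
  ... | yes gcd≡1 = induced a gcd≡1
  ... | no gcd≢1 = trans (IsDirichletCharacter.zero-off χ-char a gcd≢1)
                         (sym (IsDirichletCharacter.zero-off χ'-char a (gcd≢1 ∘ coprime-to-d)))
    where
    coprime-to-d : gcd a d' ≡.≡ 1 → gcd a (d' *ℕ ℓ) ≡.≡ 1
    coprime-to-d gcd≡1 = coprime⇒gcd≡1 (coprime-* (gcd≡1⇒coprime gcd≡1) (prime∤⇒coprime ℓ-prime ℓ∤a))

  induced-nonTrivial : ∀ {d' ℓ χ χ'} → InducedBy R (d' *ℕ ℓ) χ χ' → NonTrivial R (d' *ℕ ℓ) χ → NonTrivial R d' χ'
  induced-nonTrivial {d'} {ℓ} induced (g , gcd≡1 , χg≉1) =
    g , coprime⇒gcd≡1 (coprime-∣ʳ (m∣m*n ℓ) (gcd≡1⇒coprime {g} {d' *ℕ ℓ} gcd≡1)) , χg≉1 ∘ trans (induced g gcd≡1)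

  sumFrom1-period∸1≈0 : ∀ {n ψ} → IsDirichletCharacter R n ψ → 1 < n → sumFrom1 R ψ n ≈ 0# →
                        sumFrom1 R ψ (n ∸ 1) ≈ 0#
  sumFrom1-period∸1≈0 {suc m} {ψ} ψ-char 1<n period≈0 = begin
    sumFrom1 R ψ m           ≈⟨ +-identityʳ _ ⟨
    sumFrom1 R ψ m + 0#      ≈⟨ +-congˡ ψ[n]≈0 ⟨
    sumFrom1 R ψ (suc m)     ≈⟨ period≈0 ⟩
    0#                       ∎
    where
    ψ[n]≈0 : ψ (suc m) ≈ 0#
    ψ[n]≈0 = IsDirichletCharacter.zero-off ψ-char (suc m)
               (λ gcd≡1 → ℕ.<⇒≢ 1<n (≡.sym (gcd≡1⇒coprime gcd≡1 (∣-refl , ∣-refl))))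

  cSum-split-multiples : ∀ {d' ℓ χ χ'} → Prime ℓ → IsDirichletCharacter R (d' *ℕ ℓ) χ → IsDirichletCharacter R d' χ' →
                         InducedBy R (d' *ℕ ℓ) χ χ' →
                         cSum R χ (d' *ℕ ℓ) + χ' ℓ * cSum R χ' d' ≈ sumFrom1 R χ' ((d' *ℕ ℓ ∸ 1) / 2)
  cSum-split-multiples {d'} {ℓ} {χ} {χ'} ℓ-prime χ-char χ'-char induced = begin
    sumFrom1 R χ N + χ' ℓ * sumFrom1 R χ' ((d' ∸ 1) / 2)
      ≡⟨ ≡.cong (λ m → sumFrom1 R χ N + χ' ℓ * sumFrom1 R χ' m) ([m*n∸1]/2/n≡[m∸1]/2 d' ℓ) ⟨
    sumFrom1 R χ N + χ' ℓ * sumFrom1 R χ' (N / ℓ)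
      ≈⟨ sumFrom1-split-multiples (zero-on-prime-multiples χ-char ℓ-prime (n∣m*n d'))
                                  (induced-off-multiples ℓ-prime χ-char χ'-char induced)
                                  (IsDirichletCharacter.multiplicative χ'-char) N ⟩
    sumFrom1 R χ' N
      ∎
    where
    instance
      ℓ≢0 : NonZero ℓ
      ℓ≢0 = prime⇒nonZero ℓ-prime
    N : ℕ
    N = (d' *ℕ ℓ ∸ 1) / 2

open import Data.Nat using (_∸_; _/_) renaming (_+_ to _+ℕ_)
open import Data.Nat.Properties using (*-cancelʳ-<)
open import Data.Product using (_,_)
open import Relation.Binary.PropositionalEquality using (refl)
import Relation.Binary.PropositionalEquality as ≡
open Arithmetic

lemma2p3 : ∀ {c ℓr} (R : CommutativeRing c ℓr) → NoZeroDivisors R →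
    (d ℓ d' : ℕ) → 2 < d → Prime ℓ → d ≡ d' *ℕ ℓ →
    (χ χ' : ℕ → CommutativeRing.Carrier R) →
    IsDirichletCharacter R d χ → IsDirichletCharacter R d' χ' →
    InducedBy R d χ χ' → NonTrivial R d χ →
    let open CommutativeRing R in
    (ℓ ≡ 2 → cSum R χ d ≈ - (χ' 2 * cSum R χ' d'))
    × (ℓ ≢ 2 → cSum R χ d ≈ ((1# - χ' ℓ) * cSum R χ' d'))
lemma2p3 R domain _ ℓ d' 2<d ℓ-prime refl χ χ' χ-char χ'-char induced nontrivial = even , odd
  where
  open CommutativeRing R
  open CharacterSums R
  open import Algebra.Properties.Ring ring using (+-inverseˡ-unique)
  split : cSum R χ (d' *ℕ ℓ) + χ' ℓ * cSum R χ' d' ≈ sumFrom1 R χ' ((d' *ℕ ℓ ∸ 1) / 2)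
  split = cSum-split-multiples ℓ-prime χ-char χ'-char induced
  period-sum≈0 : sumFrom1 R χ' d' ≈ 0#
  period-sum≈0 = nonTrivial⇒sumFrom1-period≈0 domain χ'-char (induced-nonTrivial induced nontrivial)
  even : ℓ ≡ 2 → cSum R χ (d' *ℕ ℓ) ≈ - (χ' 2 * cSum R χ' d')
  even ≡.refl = +-inverseˡ-unique _ _ (trans split (trans
    (reflexive (≡.cong (sumFrom1 R χ') ([m*2∸1]/2≡m∸1 d')))
    (sumFrom1-period∸1≈0 χ'-char (*-cancelʳ-< 2 1 d' 2<d) period-sum≈0)))
  odd : ℓ ≢ 2 → cSum R χ (d' *ℕ ℓ) ≈ ((1# - χ' ℓ) * cSum R χ' d')
  odd ℓ≢2 = x+ky≈y⇒x≈[1-k]y _ _ _ (trans split (trans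
    (reflexive (≡.cong (sumFrom1 R χ') half-period-shift))
    (sumFrom1-+-periods (IsDirichletCharacter.periodic χ'-char) period-sum≈0 ((d' ∸ 1) / 2) k)))
    where
    k : ℕ
    k = ℓ / 2
    half-period-shift : (d' *ℕ ℓ ∸ 1) / 2 ≡ (d' ∸ 1) / 2 +ℕ k *ℕ d'
    half-period-shift = ≡.trans (≡.cong (λ p → (d' *ℕ p ∸ 1) / 2) (odd-prime ℓ-prime ℓ≢2))
                                ([m*[1+k*2]∸1]/2≡[m∸1]/2+k*m d' k)
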